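{- The splitting graph $\mathrm{Spltg}(B_G)$ of the bull graph $B_G$ admits a signed product cordial labeling.
   Context: All graphs are finite, simple and undirected. A vertex labeling $\alpha: V(G) \to \{1,-1\}$ induces the edge labeling $\alpha^*: E(G) \to \{1,-1\}$ given by $\alpha^*(uv) = \alpha(u)\alpha(v)$. For $a \in \{1,-1\}$, let $v_\alpha(a)$ be the number of vertices labeled $a$ and $e_{\alpha^*}(a)$ the number of edges labeled $a$. The labeling $\alpha$ is a signed product cordial labeling if $|v_\alpha(-1) - v_\alpha(1)| \leq 1$ and $|e_{\alpha^*}(-1) - e_{\alpha^*}(1)| \leq 1$. The bull graph $B_G$ has vertex set $\{v_1,\dots,v_5\}$ and edge set $\{v_1v_2, v_2v_3, v_3v_4, v_4v_5, v_2v_4\}$ (a triangle $v_2v_3v_4$ with a pendant vertex attached at $v_2$ and another at $v_4$). The splitting graph $\mathrm{Spltg}(G)$ of a graph $G$ is obtained from $G$ by adding, for each vertex $v$ of $G$, a new vertex $v'$ and joining $v'$ to every vertex of $G$ adjacent to $v$; the new vertices are pairwise non-adjacent. -}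

module Defs where

open import Data.Nat using (ℕ; _+_; _≤_)
open import Data.Fin using (Fin; _↑ˡ_; _↑ʳ_)
open import Data.List using (List; []; _∷_; _++_; length; filter; concatMap; allFin)
open import Data.Product using (_×_; _,_)
open import Data.Bool using (Bool; true; false)
open import Relation.Nullary using (Dec; yes; no)
open import Relation.Binary.PropositionalEquality using (_≡_)
open import Data.Fin.Patterns

data Sign : Set where
  plus minus : Sign

_≟ˢ_ : (a b : Sign) → Dec (a ≡ b)
plus ≟ˢ plus = yes _≡_.refl
plus ≟ˢ minus = no (λ ())
minus ≟ˢ plus = no (λ ())
minus ≟ˢ minus = yes _≡_.refl

_·_ : Sign → Sign → Sign
plus · b = b
minus · plus = minus
minus · minus = plus

-- A finite simple graph on vertex set Fin n, given by its list of edges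
-- (each unordered edge listed exactly once as a pair of distinct vertices).
record Graph : Set where
  constructor mkGraph
  field
    order : ℕ
    edges : List (Fin order × Fin order)
open Graph public

-- Bull graph: v1..v5 as 0..4; edges v1v2, v2v3, v3v4, v4v5, v2v4
bull : Graph
bull = mkGraph 5 ((0F , 1F) ∷ (1F , 2F) ∷ (2F , 3F) ∷ (3F , 4F) ∷ (1F , 3F) ∷ [])

-- Splitting graph: vertices v ↦ v ↑ˡ n (original), v' ↦ n ↑ʳ v (new).
-- Edges: all edges uv of G, plus u'v and uv' for every edge uv of G
-- (v' is joined to exactly the neighbours of v in G).
splitting : Graph → Graph
splitting (mkGraph n es) = mkGraph (n + n)
  (concatMap (λ { (u , v) →
       (u ↑ˡ n , v ↑ˡ n)
     ∷ (n ↑ʳ u , v ↑ˡ n)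
     ∷ (u ↑ˡ n , n ↑ʳ v) ∷ [] }) es)

vcount : (G : Graph) → (Fin (order G) → Sign) → Sign → ℕ
vcount G α a = length (filter (λ v → α v ≟ˢ a) (allFin (order G)))

ecount : (G : Graph) → (Fin (order G) → Sign) → Sign → ℕ
ecount G α a = length (filter (λ { (u , v) → (α u · α v) ≟ˢ a }) (edges G))

AbsDiffLe1 : ℕ → ℕ → Set
AbsDiffLe1 x y = (x ≤ y + 1) × (y ≤ x + 1)

IsSignedProductCordial : (G : Graph) → (Fin (order G) → Sign) → Set
IsSignedProductCordial G α =
  AbsDiffLe1 (vcount G α minus) (vcount G α plus) ×
  AbsDiffLe1 (ecount G α minus) (ecount G α plus)

{-# OPTIONS --safe #-}
module Submission where

open import Defs
open import Data.Fin using (Fin)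
open import Data.Fin.Patterns
open import Data.Nat using (suc; _+_; _≤_)
open import Data.Nat.Properties using (≤-refl; m≤m+n; n≤1+n; m≤n⇒m≤n+o; +-comm)
open import Data.Product using (Σ; _×_; _,_)
open import Relation.Binary.PropositionalEquality using (_≡_; refl; subst)

absDiffLe1-refl : ∀ n → AbsDiffLe1 n n
absDiffLe1-refl n = m≤m+n n 1 , m≤m+n n 1

absDiffLe1-suc : ∀ n → AbsDiffLe1 n (suc n)
absDiffLe1-suc n = m≤n⇒m≤n+o 1 (n≤1+n n) , subst (suc n ≤_) (+-comm 1 n) ≤-refl

-- 0F–4F are v₁…v₅ and 5F–9F are v₁'…v₅': only v₅ and the copies v₁', v₃', v₄', v₅' get −1.
splitBullLabelling : Fin (order (splitting bull)) → Sign
splitBullLabelling 0F = plus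
splitBullLabelling 1F = plus
splitBullLabelling 2F = plus
splitBullLabelling 3F = plus
splitBullLabelling 4F = minus
splitBullLabelling 5F = minus
splitBullLabelling 6F = plus
splitBullLabelling 7F = minus
splitBullLabelling 8F = minus
splitBullLabelling 9F = minus

splitBull-vertexCounts :
  vcount (splitting bull) splitBullLabelling minus ≡ 5 × vcount (splitting bull) splitBullLabelling plus ≡ 5
splitBull-vertexCounts = refl , refl

splitBull-edgeCounts :
  ecount (splitting bull) splitBullLabelling minus ≡ 7 × ecount (splitting bull) splitBullLabelling plus ≡ 8
splitBull-edgeCounts = refl , refl

balanced-of-counts : ∀ {x y m n} → x ≡ m × y ≡ n → AbsDiffLe1 m n → AbsDiffLe1 x y
balanced-of-counts (refl , refl) balanced = balanced

theorem2p2 : Σ (Fin (order (splitting bull)) → Sign) (λ α → IsSignedProductCordial (splitting bull) α)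
theorem2p2 = splitBullLabelling
           , balanced-of-counts splitBull-vertexCounts (absDiffLe1-refl 5)
           , balanced-of-counts splitBull-edgeCounts (absDiffLe1-suc 7)
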